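{- Let $G$ be a tree on $k$ vertices, $n\ge1$, $e=(s,t)$ an edge of $G$, and let $\{u,v\}$ be a special edge of the unique $e$-cycle of length $2^n$ in $\Gamma^G_n$. Then \[ n(u,v)\,n(v,u) = n_G(s,t)\,n_G(t,s)\,k^{2(n-1)} = n_G(s,t)\,k^{n-1}\left(k^n-n_G(s,t)k^{n-1}\right) = n_G(t,s)\,k^{n-1}\left(k^n-n_G(t,s)k^{n-1}\right), \] where $n(u,v),n(v,u)$ are computed in $\Gamma^G_n$ and $n_G(s,t),n_G(t,s)$ in $G$.
   Context: Let $G$ be a finite tree with vertex set $V$, $|V|=k$, and fix an orientation of each edge. For an oriented edge $e=(s,t)$ of $G$ define a bijection $e$ of the set $V^n$ of words of length $n$ over $V$ recursively: $e$ fixes the empty word, and for a letter $z\in V$ and a word $w$, $e(sw)=t\,e(w)$, $e(tw)=sw$, and $e(zw)=zw$ for $z\notin\{s,t\}$. The $n$-th Schreier graph $\Gamma^G_n$ is the multigraph with vertex set $V^n$ having, for each word $u\in V^n$ and each edge $e$ of $G$, one edge labelled $e$ joining $u$ and $e(u)$. The edges labelled $e$ decompose into one cycle per orbit of $e$ on $V^n$; these are the $e$-cycles. The unique $e$-cycle of length $2^n$ has vertex set $\{s,t\}^n$; its special edges are the edge labelled $e$ joining $s^n$ and $t^n$ and the edge labelled $e$ joining $s^{n-1}t$ and $t^{n-1}s$. For adjacent vertices $u,v$ of a graph, $n(u,v)$ denotes the number of vertices strictly closer (in graph distance) to $u$ than to $v$. -}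

module Defs where

open import Data.Nat using (ℕ; zero; suc; _<_; _≤_)
open import Data.Fin using (Fin; _≟_)
open import Data.Vec using (Vec; []; _∷_; replicate; _∷ʳ_)
open import Data.List using (List; []; _∷_; length)
open import Data.List.Membership.Propositional using (_∈_; _∉_)
open import Data.List.Relation.Unary.Unique.Propositional using (Unique)
open import Data.List.Relation.Unary.All using (All)
open import Data.Product using (Σ; ∃; _×_; _,_)
open import Data.Sum using (_⊎_)
open import Relation.Nullary using (¬_; yes; no)
open import Relation.Binary.PropositionalEquality using (_≡_; _≢_)
open import Function.Bundles using (_⇔_)

module _ {A : Set} (Adj : A → A → Set) where

  data Walk : A → A → ℕ → Set where
    here : ∀ {x} → Walk x x zero
    step : ∀ {x y z m} → Adj x y → Walk y z m → Walk x z (suc m)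

  Dist : A → A → ℕ → Set
  Dist x y d = Walk x y d × (∀ m → m < d → ¬ Walk x y m)

  Closer : A → A → A → Set
  Closer u v x = Σ ℕ λ d → Dist x u d × (∀ d' → Dist x v d' → d < d')

  HasCount : (A → Set) → ℕ → Set
  HasCount P N = Σ (List A) λ xs → Unique xs × (∀ x → (x ∈ xs) ⇔ P x) × length xs ≡ N

  nCloser : A → A → ℕ → Set
  nCloser u v N = HasCount (Closer u v) N

  Connected : Set
  Connected = ∀ x y → Σ ℕ λ m → Walk x y m

  data Chain : List A → Set where
    c[]  : Chain []
    c[x] : ∀ {x} → Chain (x ∷ [])
    c∷   : ∀ {x y xs} → Adj x y → Chain (y ∷ xs) → Chain (x ∷ y ∷ xs)

  -- a cycle: at least 3 distinct vertices x₀,…,x_{r-1}, consecutive ones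
  -- adjacent and x_{r-1} adjacent to x₀
  record Cycle : Set where
    field
      first  : A
      rest   : List A
      last   : A
      len≥1  : 1 ≤ length rest
      uniq   : Unique (first ∷ Data.List._++_ rest (last ∷ []))
      chain  : Chain (first ∷ Data.List._++_ rest (last ∷ []))
      close  : Adj last first

  Acyclic : Set
  Acyclic = ¬ Cycle

Edges : ℕ → Set
Edges k = List (Fin k × Fin k)

AdjG : ∀ {k} → Edges k → Fin k → Fin k → Set
AdjG E x y = ((x , y) ∈ E) ⊎ ((y , x) ∈ E)

Simple : ∀ {k} → Edges k → Set
Simple {k} E = All (λ { (s , t) → s ≢ t }) E × Unique E
             × (∀ (s t : Fin k) → (s , t) ∈ E → (t , s) ∉ E)

IsTree : ∀ {k} → Edges k → Set
IsTree E = Simple E × Connected (AdjG E) × Acyclic (AdjG E)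

act : ∀ {k n} → Fin k × Fin k → Vec (Fin k) n → Vec (Fin k) n
act e [] = []
act (s , t) (z ∷ w) with z ≟ s
... | yes _ = t ∷ act (s , t) w
... | no _ with z ≟ t
...   | yes _ = s ∷ w
...   | no _  = z ∷ w

-- adjacency in the Schreier graph Γ^G_n (edges labelled e join u and e(u))
AdjΓ : ∀ {k} → Edges k → (n : ℕ) → Vec (Fin k) n → Vec (Fin k) n → Set
AdjΓ E n u w = Σ (Fin _ × Fin _) λ e → e ∈ E × ((act e u ≡ w) ⊎ (act e w ≡ u))

-- {u , v} is a special edge of the e-cycle of length 2^(m+1), e = (s , t):
-- {u , v} = {s^(m+1) , t^(m+1)} or {s^m t , t^m s}
SpecialEdge : ∀ {k} (m : ℕ) (s t : Fin k) → Vec (Fin k) (suc m) → Vec (Fin k) (suc m) → Set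
SpecialEdge m s t u v =
    (u ≡ replicate (suc m) s × v ≡ replicate (suc m) t)
  ⊎ (u ≡ replicate (suc m) t × v ≡ replicate (suc m) s)
  ⊎ (u ≡ replicate m s ∷ʳ t × v ≡ replicate m t ∷ʳ s)
  ⊎ (u ≡ replicate m t ∷ʳ s × v ≡ replicate m s ∷ʳ t)

-- Let NearS be the set of vertices of G strictly closer to s than to t.  As G is a
-- tree, st is the only edge between NearS and its complement, so every vertex is
-- strictly closer to exactly one of s, t and n_G(s,t) + n_G(t,s) = k.
--
-- In Γ_n an edge labelled (a,b) changes the last letter of a word only on aⁿ and
-- aᵐb (n = m + 1), so the only edges between the words whose last letter lies in
-- NearS and the other words are the special edges {sⁿ, tⁿ} and {sᵐt, tᵐs}.  The map
-- Φ, which retracts Γ_n onto the e-cycle {s,t}ⁿ and then exchanges s and t, never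
-- increases distances and exchanges the ends of both special edges.  Hence a walk
-- from an s-side word to tⁿ can always be replaced by a shorter one to sⁿ: it leaves
-- the s-side either through sⁿ – tⁿ, or through tᵐs – sᵐt and then Φ turns its
-- remainder sᵐt ⇝ tⁿ into a walk tᵐs ⇝ sⁿ that is no longer.  So the words closer
-- to sⁿ than to tⁿ are those whose last letter lies in NearS, k^m n_G(s,t) of them;
-- symmetrically for the other side and the other special edge.  The identities are
-- then arithmetic.

module Submission where

open import Defs
open import Data.Nat using (ℕ; zero; suc; _+_; _*_; _∸_; _^_; _≤_; _<_; z≤n; s≤s)
open import Data.Nat.Properties
  using ( ≤-refl; ≤-trans; <-trans; <⇒≤; <-≤-trans; ≤-<-trans; <-irrefl; ≮⇒≥; <-cmp; _<?_
        ; +-comm; +-identityʳ; *-comm; *-distribʳ-+; ^-distribˡ-+-*; m+n∸m≡n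
        ; +-cancelˡ-≤; +-cancelˡ-<; m≤n+m; m≤n⇒m≤1+n; anyUpTo? )
open import Data.Nat.Induction using (<-rec)
open import Data.Nat.Solver using (module +-*-Solver)
open import Data.Fin using (Fin; _≟_)
open import Data.Fin.Properties using () renaming (any? to search-Fin)
open import Data.Vec using (Vec; []; _∷_; _∷ʳ_; last; initLast; replicate; map)
open import Data.Vec.Properties using (∷-injective; ∷ʳ-injective; last-∷ʳ; map-replicate; map-∷ʳ)
import Data.Vec.Properties as Vec
import Data.Vec.Relation.Unary.All as Vec
open import Data.List using (List; []; _∷_; _++_; length; allFin; cartesianProductWith)
import Data.List as List
open import Data.List.Properties using (length-++; length-map; length-tabulate)
open import Data.List.Membership.Propositional using (_∈_; _∉_; find; lose)
open import Data.List.Membership.Propositional.Properties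
  using (∈-++⁺ˡ; ∈-++⁺ʳ; ∈-allFin; ∈-cartesianProductWith⁺; ∈-cartesianProductWith⁻)
open import Data.List.Membership.Propositional.Properties.WithK using (unique∧set⇒bag)
import Data.List.Membership.DecPropositional as DecMembership
open import Data.List.Relation.Binary.BagAndSetEquality using (∼bag⇒↭)
open import Data.List.Relation.Binary.Permutation.Propositional.Properties using (↭-length)
open import Data.List.Relation.Unary.Any using (here; there; any?)
open import Data.List.Relation.Unary.All using ([]; lookup)
open import Data.List.Relation.Unary.All.Properties using (¬Any⇒All¬)
open import Data.List.Relation.Unary.AllPairs using ([]; _∷_)
open import Data.List.Relation.Unary.Unique.Propositional using (Unique)
open import Data.List.Relation.Unary.Unique.Propositional.Properties using (++⁺; allFin⁺; cartesianProductWith⁺)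
open import Data.Product using (∃; ∃₂; _×_; _,_; proj₁; proj₂)
import Data.Product as Product
open import Data.Product.Properties using (≡-dec)
open import Data.Sum using (_⊎_; inj₁; inj₂; [_,_]′)
import Data.Sum as Sum
open import Data.Empty using (⊥; ⊥-elim)
open import Function.Base using (_∘_; id)
open import Function.Bundles using (_⇔_; mk⇔; Equivalence)
open import Relation.Nullary using (¬_; ¬?; Dec; yes; no; contradiction)
open import Relation.Nullary.Decidable using (map′; _×-dec_; _⊎-dec_; decidable-stable)
open import Relation.Unary using (Decidable)
open import Relation.Binary using (DecidableEquality)
open import Relation.Binary.Definitions using (tri<; tri≈; tri>)
open import Relation.Binary.PropositionalEquality using (_≡_; _≢_; refl; sym; trans; cong; cong₂; subst; subst₂)
open Relation.Binary.PropositionalEquality.≡-Reasoning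

-- Walks and distances in an arbitrary graph

least : {P : ℕ → Set} → Decidable P → ∀ {L} → P L →
        ∃ λ d → (P d × (∀ m → m < d → ¬ P m)) × d ≤ L
least {P} P? {L} = <-rec Goal search L
  where
  Goal : ℕ → Set
  Goal L = P L → ∃ λ d → (P d × (∀ m → m < d → ¬ P m)) × d ≤ L
  search : ∀ L → (∀ {m} → m < L → Goal m) → Goal L
  search L below pL with anyUpTo? P? L
  ... | yes (m , m<L , pm) = let d , least-d , d≤m = below m<L pm in d , least-d , ≤-trans d≤m (<⇒≤ m<L)
  ... | no  none           = L , (pL , λ m m<L pm → none (m , m<L , pm)) , ≤-refl

module _ {A : Set} {Adj : A → A → Set} where

  infixr 5 _++ʷ_
  _++ʷ_ : ∀ {x y z m n} → Walk Adj x y m → Walk Adj y z n → Walk Adj x z (m + n)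
  here     ++ʷ q = q
  step a p ++ʷ q = step a (p ++ʷ q)

  departures : ∀ {x y m} → Walk Adj x y m → List A
  departures here               = []
  departures (step {x = x} _ w) = x ∷ departures w

  vertices : ∀ {x y m} → Walk Adj x y m → List A
  vertices {y = y} w = departures w ++ y ∷ []

  vertices-++-step : ∀ {x y z w m n} (p : Walk Adj x y m) (a : Adj y z) (q : Walk Adj z w n) →
                     vertices (p ++ʷ step a q) ≡ vertices p ++ vertices q
  vertices-++-step here               a q = refl
  vertices-++-step (step {x = x} _ p) a q = cong (x ∷_) (vertices-++-step p a q)

  split : ∀ {x y z m} (w : Walk Adj x y m) → z ∈ vertices w →
          ∃₂ λ i j → i + j ≡ m × Walk Adj x z i × Walk Adj z y j
  split here (here refl) = 0 , 0 , refl , here , here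
  split {m = m} (step a w) (here refl) = 0 , m , refl , here , step a w
  split (step a w) (there z∈w) =
    let i , j , i+j≡m , w₁ , w₂ = split w z∈w in suc i , j , cong suc i+j≡m , step a w₁ , w₂

  shortest-vertices-unique : ∀ {x y m} (w : Walk Adj x y m) → (∀ l → l < m → ¬ Walk Adj x y l) →
                             Unique (vertices w)
  shortest-vertices-unique here _ = [] ∷ []
  shortest-vertices-unique {x} (step {m = m} a w) shortest =
    ¬Any⇒All¬ (vertices w) x∉w ∷ shortest-vertices-unique w (λ l l<m v → shortest (suc l) (s≤s l<m) (step a v))
    where
    x∉w : x ∉ vertices w
    x∉w x∈w = let i , j , i+j≡m , _ , w₂ = split w x∈w in
      shortest j (s≤s (subst (j ≤_) i+j≡m (m≤n+m j i))) w₂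

  vertices-chain : ∀ {x y m} (w : Walk Adj x y m) → Chain Adj (vertices w)
  vertices-chain here                = c[x]
  vertices-chain (step a here)       = c∷ a c[x]
  vertices-chain (step a (step b w)) = c∷ a (vertices-chain (step b w))

  cycle-closing : ∀ {x y m} (w : Walk Adj x y m) → 2 ≤ m → Unique (vertices w) → Adj y x → Cycle Adj
  cycle-closing (step _ here) (s≤s ())
  cycle-closing {x} {y} w@(step _ w′@(step _ _)) _ w! y~x = record
    { first = x ; rest = departures w′ ; last = y ; len≥1 = s≤s z≤n
    ; uniq = w! ; chain = vertices-chain w ; close = y~x }

  Dist-unique : ∀ {x y d e} → Dist Adj x y d → Dist Adj x y e → d ≡ e
  Dist-unique {d = d} {e} (w , min-d) (v , min-e) with <-cmp d e
  ... | tri< d<e _ _ = contradiction w (min-e d d<e)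
  ... | tri≈ _ d≡e _ = d≡e
  ... | tri> _ _ e<d = contradiction v (min-d e e<d)

  Shortcut : A → A → A → Set
  Shortcut a b x = ∀ {L} → Walk Adj x b L → ∃ λ L′ → L′ < L × Walk Adj x a L′

  module _ {P : A → Set} (P? : Decidable P) {a b : A} (b∉P : ¬ P b)
           (exit : ∀ {x y} → P x → ¬ P y → Adj x y →
                   ∀ {l} → Walk Adj y b l → ∃ λ l′ → l′ ≤ l × Walk Adj x a l′) where

    Shortcut-inside : ∀ {x} → P x → Shortcut a b x
    Shortcut-inside x∈P here = contradiction x∈P b∉P
    Shortcut-inside x∈P (step {y = y} x~y w) with P? y
    ... | yes y∈P = let L′ , L′<L , v = Shortcut-inside y∈P w in suc L′ , s≤s L′<L , step x~y v
    ... | no  y∉P = let l′ , l′≤l , v = exit x∈P y∉P x~y w in l′ , s≤s l′≤l , v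

  module Distances (walk? : ∀ x y m → Dec (Walk Adj x y m)) where

    shortest : ∀ {x y L} → Walk Adj x y L → ∃ λ d → Dist Adj x y d × d ≤ L
    shortest = least (walk? _ _)

    Closer⇒< : ∀ {a b x L} → ((d , _) : Closer Adj a b x) → Walk Adj x b L → d < L
    Closer⇒< (_ , _ , nearer) w = let _ , D , d′≤L = shortest w in <-≤-trans (nearer _ D) d′≤L

    ¬Closer⇒≤ : ∀ {a b x q L} → ¬ Closer Adj a b x → Dist Adj x b q → Walk Adj x a L → q ≤ L
    ¬Closer⇒≤ {q = q} not-closer Db w with shortest w
    ... | d , Da , d≤L with d <? q
    ...   | yes d<q = contradiction (d , Da , λ _ Db′ → subst (d <_) (Dist-unique Db Db′) d<q) not-closer
    ...   | no  d≮q = ≤-trans (≮⇒≥ d≮q) d≤L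

    Closer⇒Shortcut : ∀ {a b x} → Closer Adj a b x → Shortcut a b x
    Closer⇒Shortcut c@(_ , (v , _) , _) w = _ , Closer⇒< c w , v

    Shortcut⇒Closer : ∀ {a b x L} → Walk Adj x a L → Shortcut a b x → Closer Adj a b x
    Shortcut⇒Closer w shortcut with shortest w
    ... | d , Da@(_ , min-d) , _ = d , Da , nearer
      where
      nearer : ∀ e → Dist Adj _ _ e → d < e
      nearer e (v , _) = let L′ , L′<e , v′ = shortcut v in ≤-<-trans (≮⇒≥ (λ L′<d → min-d L′ L′<d v′)) L′<e

    Shortcut⇒¬Closer : ∀ {a b x} → Shortcut b a x → ¬ Closer Adj a b x
    Shortcut⇒¬Closer shortcut c@(_ , (v , _) , _) =
      let _ , L′<d , v′ = shortcut v in <-irrefl refl (<-trans (Closer⇒< c v′) L′<d)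

    closer? : Connected Adj → ∀ a b → Decidable (Closer Adj a b)
    closer? connected a b x with shortest (proj₂ (connected x a)) | shortest (proj₂ (connected x b))
    ... | da , Da , _ | db , Db , _ with da <? db
    ...   | yes da<db = yes (da , Da , λ _ Db′ → subst (da <_) (Dist-unique Db Db′) da<db)
    ...   | no  da≮db = no λ (d , Da′ , nearer) → da≮db (subst (_< db) (Dist-unique Da′ Da) (nearer db Db))

    Closer-by-cut : Connected Adj → ∀ {P : A → Set} → Decidable P → ∀ {a b} →
                    (∀ {x} → P x → Shortcut a b x) → (∀ {x} → ¬ P x → Shortcut b a x) →
                    ∀ x → (Closer Adj a b x ⇔ P x) × (Closer Adj b a x ⇔ (¬ P x))
    Closer-by-cut connected {P} P? {a} {b} inside outside x =
      mk⇔ to (λ x∈P → Shortcut⇒Closer (proj₂ (connected x a)) (inside x∈P)) ,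
      mk⇔ (λ c x∈P → Shortcut⇒¬Closer (inside x∈P) c)
          (λ x∉P → Shortcut⇒Closer (proj₂ (connected x b)) (outside x∉P))
      where
      to : Closer Adj a b x → P x
      to c with P? x
      ... | yes x∈P = x∈P
      ... | no  x∉P = contradiction c (Shortcut⇒¬Closer (outside x∉P))

module _ {A : Set} {Adj : A → A → Set} (Adj-sym : ∀ {x y} → Adj x y → Adj y x) where

  reverse : ∀ {x y m} → Walk Adj x y m → Walk Adj y x m
  reverse here               = here
  reverse (step {m = m} a w) = subst (Walk Adj _ _) (+-comm m 1) (reverse w ++ʷ step (Adj-sym a) here)

  Dist-sym : ∀ {x y d} → Dist Adj x y d → Dist Adj y x d
  Dist-sym (w , min-d) = reverse w , λ l l<d v → min-d l l<d (reverse v)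

module _ {A B : Set} {R : A → A → Set} {S : B → B → Set} (f : A → B) where

  Walk-map : (∀ {x y} → R x y → S (f x) (f y)) → ∀ {x y l} → Walk R x y l → Walk S (f x) (f y) l
  Walk-map f-edge here       = here
  Walk-map f-edge (step a w) = step (f-edge a) (Walk-map f-edge w)

  Walk-map-≤ : (∀ {x y} → R x y → f x ≡ f y ⊎ S (f x) (f y)) →
               ∀ {x y l} → Walk R x y l → ∃ λ l′ → l′ ≤ l × Walk S (f x) (f y) l′
  Walk-map-≤ f-edge here = 0 , z≤n , here
  Walk-map-≤ f-edge {y = z} (step a w) with Walk-map-≤ f-edge w | f-edge a
  ... | l′ , l′≤l , v | inj₁ fx≡fy = l′ , m≤n⇒m≤1+n l′≤l , subst (λ u → Walk S u (f z) l′) (sym fx≡fy) v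
  ... | l′ , l′≤l , v | inj₂ b     = suc l′ , s≤s l′≤l , step b v

walk? : ∀ {A : Set} {Adj : A → A → Set} → DecidableEquality A →
        (∀ {Q : A → Set} → Decidable Q → Dec (∃ Q)) → (∀ x y → Dec (Adj x y)) →
        ∀ x y m → Dec (Walk Adj x y m)
walk? _≟_ search adj? x y zero = map′ (λ { refl → here }) (λ { here → refl }) (x ≟ y)
walk? _≟_ search adj? x y (suc m) =
  map′ (λ (_ , a , w) → step a w) (λ { (step a w) → _ , a , w })
       (search (λ z → adj? x z ×-dec walk? _≟_ search adj? z y m))

-- Counting

same-members⇒same-length : ∀ {A : Set} {xs ys : List A} → Unique xs → Unique ys →
                           (∀ {x} → (x ∈ xs) ⇔ (x ∈ ys)) → length xs ≡ length ys
same-members⇒same-length xs! ys! same = ↭-length (∼bag⇒↭ (unique∧set⇒bag xs! ys! same))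

-- HasCount does not use its adjacency argument, so it cannot be inferred and is passed explicitly.
module _ {A : Set} (Adj : A → A → Set) where

  HasCount-unique : ∀ {P N M} → HasCount Adj P N → HasCount Adj P M → N ≡ M
  HasCount-unique (xs , xs! , ∈xs , refl) (ys , ys! , ∈ys , refl) = same-members⇒same-length xs! ys! λ {x} →
    mk⇔ (Equivalence.from (∈ys x) ∘ Equivalence.to (∈xs x)) (Equivalence.from (∈xs x) ∘ Equivalence.to (∈ys x))

  HasCount-resp : ∀ {P Q N} → (∀ x → P x ⇔ Q x) → HasCount Adj P N → HasCount Adj Q N
  HasCount-resp P⇔Q (xs , xs! , ∈xs , len) =
    xs , xs! ,
    (λ x → mk⇔ (Equivalence.to (P⇔Q x) ∘ Equivalence.to (∈xs x))
               (Equivalence.from (∈xs x) ∘ Equivalence.from (P⇔Q x))) ,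
    len

HasCount-partition : ∀ {k} (Adj : Fin k → Fin k → Set) {P : Fin k → Set} → Decidable P →
                     ∀ {N M} → HasCount Adj P N → HasCount Adj (¬_ ∘ P) M → N + M ≡ k
HasCount-partition {k} Adj {P} P? (ys , ys! , ∈ys , refl) (zs , zs! , ∈zs , refl) = begin
  length ys + length zs  ≡⟨ length-++ ys ⟨
  length (ys ++ zs)      ≡⟨ same-members⇒same-length (++⁺ ys! zs! disjoint) (allFin⁺ k) (mk⇔ (λ _ → ∈-allFin _) from) ⟩
  length (allFin k)      ≡⟨ length-tabulate {n = k} id ⟩
  k                      ∎
  where
  disjoint : ∀ {x} → ¬ (x ∈ ys × x ∈ zs)
  disjoint {x} (x∈ys , x∈zs) = Equivalence.to (∈zs x) x∈zs (Equivalence.to (∈ys x) x∈ys)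
  from : ∀ {x} → x ∈ allFin k → x ∈ ys ++ zs
  from {x} _ with P? x
  ... | yes x∈P = ∈-++⁺ˡ (Equivalence.from (∈ys x) x∈P)
  ... | no  x∉P = ∈-++⁺ʳ ys (Equivalence.from (∈zs x) x∉P)

length-cartesianProductWith : ∀ {A B C : Set} (f : A → B → C) xs ys →
                              length (cartesianProductWith f xs ys) ≡ length xs * length ys
length-cartesianProductWith f []       ys = refl
length-cartesianProductWith f (x ∷ xs) ys =
  trans (length-++ (List.map (f x) ys)) (cong₂ _+_ (length-map (f x) ys) (length-cartesianProductWith f xs ys))

words : ∀ k n → List (Vec (Fin k) n)
words k zero    = [] ∷ []
words k (suc n) = cartesianProductWith _∷_ (allFin k) (words k n)

∈-words : ∀ {k n} (w : Vec (Fin k) n) → w ∈ words k n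
∈-words []      = here refl
∈-words (z ∷ w) = ∈-cartesianProductWith⁺ _∷_ (∈-allFin z) (∈-words w)

words-unique : ∀ k n → Unique (words k n)
words-unique k zero    = [] ∷ []
words-unique k (suc n) = cartesianProductWith⁺ _∷_ ∷-injective (allFin⁺ k) (words-unique k n)

length-words : ∀ k n → length (words k n) ≡ k ^ n
length-words k zero    = refl
length-words k (suc n) = trans (length-cartesianProductWith _∷_ (allFin k) (words k n))
                               (cong₂ _*_ (length-tabulate {n = k} id) (length-words k n))

search-words : ∀ {k n} {Q : Vec (Fin k) n → Set} → Decidable Q → Dec (∃ Q)
search-words Q? =
  map′ (λ any → let w , _ , q = find any in w , q) (λ (w , q) → lose (∈-words w) q) (any? Q? (words _ _))

HasCount-last : ∀ {k m} (G : Fin k → Fin k → Set) (Γ : Vec (Fin k) (suc m) → Vec (Fin k) (suc m) → Set) →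
                ∀ {R N} → HasCount G R N → HasCount Γ (R ∘ last) (k ^ m * N)
HasCount-last {k} {m} G Γ {R} (ys , ys! , ∈ys , refl) =
  cartesianProductWith _∷ʳ_ (words k m) ys ,
  cartesianProductWith⁺ _∷ʳ_ (∷ʳ-injective _ _) (words-unique k m) ys! ,
  (λ x → mk⇔ (to x) (from x)) ,
  trans (length-cartesianProductWith _∷ʳ_ (words k m) ys) (cong (_* length ys) (length-words k m))
  where
  to : ∀ x → x ∈ cartesianProductWith _∷ʳ_ (words k m) ys → R (last x)
  to x x∈ with ∈-cartesianProductWith⁻ _∷ʳ_ (words k m) ys x∈
  ... | w , y , _ , y∈ys , refl = subst R (sym (last-∷ʳ y w)) (Equivalence.to (∈ys y) y∈ys)
  from : ∀ x → R (last x) → x ∈ cartesianProductWith _∷ʳ_ (words k m) ys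
  from x r = let w , y , x≡w∷ʳy = initLast x in
    subst (_∈ _) (sym x≡w∷ʳy) (∈-cartesianProductWith⁺ _∷ʳ_ (∈-words w) (Equivalence.from (∈ys y) r))

-- Trees: the two sides of an edge

AdjG-sym : ∀ {k} {E : Edges k} {x y} → AdjG E x y → AdjG E y x
AdjG-sym (inj₁ xy) = inj₂ xy
AdjG-sym (inj₂ yx) = inj₁ yx

AdjG? : ∀ {k} (E : Edges k) x y → Dec (AdjG E x y)
AdjG? E x y = (x , y) ∈? E ⊎-dec (y , x) ∈? E
  where open DecMembership (≡-dec _≟_ _≟_) using (_∈?_)

module Tree {k : ℕ} {E : Edges k} (tree : IsTree E) {s t : Fin k} (st : (s , t) ∈ E) where

  G : Fin k → Fin k → Set
  G = AdjG E

  open Distances (walk? _≟_ search-Fin (AdjG? E))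

  connected : Connected G
  connected = proj₁ (proj₂ tree)

  acyclic : Acyclic G
  acyclic = proj₂ (proj₂ tree)

  s≢t : s ≢ t
  s≢t = lookup (proj₁ (proj₁ tree)) st

  ts∉E : (t , s) ∉ E
  ts∉E = proj₂ (proj₂ (proj₁ tree)) s t st

  NearS : Fin k → Set
  NearS = Closer G s t

  -- Opaque: nothing depends on how the decision is computed, and unfolding it is slow.
  opaque
    nearS? : Decidable NearS
    nearS? = closer? connected s t

  s-nearS : NearS s
  s-nearS = 0 , (here , λ _ ()) , λ { zero (here , _) → contradiction refl s≢t ; (suc _) _ → s≤s z≤n }

  t-not-nearS : ¬ NearS t
  t-not-nearS (_ , _ , nearer) with nearer 0 (here , λ _ ())
  ... | ()

  -- Shortest walks x ⇝ s and t ⇝ y, joined by st and closed by yx, would form a cycle: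
  -- a common vertex would give a walk x ⇝ t of length at most d(x,s) or a walk
  -- y ⇝ s shorter than d(y,t).
  crossing-cycle : ∀ {x y q} → G y x → ((p , _) : NearS x) → ¬ NearS y → Dist G y t q → 2 ≤ p + suc q → Cycle G
  crossing-cycle {y = y} {q} y~x near@(_ , (P , min-P) , _) not-near Dy 2≤ =
    cycle-closing (P ++ʷ step (inj₁ st) Q) 2≤ W-unique y~x
    where
    Q : Walk G t y q
    Q = proj₁ (Dist-sym AdjG-sym Dy)
    lengths-clash : ∀ i i′ j j′ → i + i′ < i + j → j + j′ ≤ j′ + i′ → ⊥
    lengths-clash i i′ j j′ i′<j j≤i′ = <-irrefl refl
      (<-≤-trans (+-cancelˡ-< i i′ j i′<j) (+-cancelˡ-≤ j′ j i′ (subst (_≤ j′ + i′) (+-comm j j′) j≤i′)))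
    disjoint : ∀ {v} → ¬ (v ∈ vertices P × v ∈ vertices Q)
    disjoint (v∈P , v∈Q) with split P v∈P | split Q v∈Q
    ... | i , i′ , i+i′≡p , P₁ , P₂ | j , j′ , j+j′≡q , Q₁ , Q₂ = lengths-clash i i′ j j′
      (subst (_< i + j) (sym i+i′≡p) (Closer⇒< near (P₁ ++ʷ reverse AdjG-sym Q₁)))
      (subst (_≤ j′ + i′) (sym j+j′≡q) (¬Closer⇒≤ not-near Dy (reverse AdjG-sym Q₂ ++ʷ P₂)))
    W-unique : Unique (vertices (P ++ʷ step (inj₁ st) Q))
    W-unique = subst Unique (sym (vertices-++-step P (inj₁ st) Q))
      (++⁺ (shortest-vertices-unique P min-P) (shortest-vertices-unique Q (proj₂ (Dist-sym AdjG-sym Dy))) disjoint)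

  crossing : ∀ {x y} → G y x → NearS x → ¬ NearS y → x ≡ s × y ≡ t
  crossing {y = y} y~x near not-near with near | shortest (proj₂ (connected y t))
  ... | zero , (here , _) , _ | zero , (here , _) , _ = refl , refl
  ... | c@(zero , _)  | suc q , Dy , _ = ⊥-elim (acyclic (crossing-cycle y~x c not-near Dy (s≤s (s≤s z≤n))))
  ... | c@(suc p , _) | q , Dy , _ =
    ⊥-elim (acyclic (crossing-cycle y~x c not-near Dy (s≤s (≤-trans (s≤s z≤n) (m≤n+m (suc q) p)))))

  nearT⇔¬nearS : ∀ x → Closer G t s x ⇔ (¬ NearS x)
  nearT⇔¬nearS = proj₂ ∘ Closer-by-cut connected nearS? Closer⇒Shortcut
    (Shortcut-inside (¬? ∘ nearS?) (λ s-far → s-far s-nearS) exit)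
    where
    exit : ∀ {x y} → ¬ NearS x → ¬ ¬ NearS y → G x y →
           ∀ {l} → Walk G y s l → ∃ λ l′ → l′ ≤ l × Walk G x t l′
    exit x-far y-near x~y _ with crossing x~y (decidable-stable (nearS? _) y-near) x-far
    ... | refl , refl = 0 , z≤n , here

  sides-partition : ∀ {Nst Nts} → nCloser G s t Nst → nCloser G t s Nts → Nst + Nts ≡ k
  sides-partition cst cts = HasCount-partition G nearS? cst (HasCount-resp G nearT⇔¬nearS cts)

  crossing-edge : ∀ {a b} → (a , b) ∈ E → NearS a → ¬ NearS b → a ≡ s × b ≡ t
  crossing-edge ab = crossing (inj₂ ab)

  ¬crossing-backwards : ∀ {a b} → (a , b) ∈ E → ¬ NearS a → NearS b → ⊥
  ¬crossing-backwards ab a-far b-near with crossing (inj₁ ab) b-near a-far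
  ... | refl , refl = ts∉E ab

  side : Fin k → Fin k
  side z with nearS? z
  ... | yes _ = s
  ... | no  _ = t

  side-s : side s ≡ s
  side-s with nearS? s
  ... | yes _     = refl
  ... | no  s-far = contradiction s-nearS s-far

  side-t : side t ≡ t
  side-t with nearS? t
  ... | yes t-near = contradiction t-near t-not-nearS
  ... | no  _      = refl

  side-endpoint : ∀ z → side z ≡ s ⊎ side z ≡ t
  side-endpoint z with nearS? z
  ... | yes _ = inj₁ refl
  ... | no  _ = inj₂ refl

  side-edge : ∀ {a b} → (a , b) ∈ E → (a , b) ≢ (s , t) → side a ≡ side b
  side-edge {a} {b} ab ab≢st with nearS? a | nearS? b
  ... | yes _      | yes _      = refl
  ... | no  _      | no  _      = refl
  ... | yes a-near | no  b-far  with crossing-edge ab a-near b-far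
  ...   | refl , refl = contradiction refl ab≢st
  side-edge ab _ | no a-far | yes b-near = ⊥-elim (¬crossing-backwards ab a-far b-near)

-- The action of an oriented edge on words

data Letter {k} (a b : Fin k) : Fin k → Set where
  source : Letter a b a
  target : b ≢ a → Letter a b b
  other  : ∀ {z} → z ≢ a → z ≢ b → Letter a b z

letter : ∀ {k} (a b z : Fin k) → Letter a b z
letter a b z with z ≟ a | z ≟ b
... | yes refl | _        = source
... | no  z≢a  | yes refl = target z≢a
... | no  z≢a  | no  z≢b  = other z≢a z≢b

module _ {k n : ℕ} (a b : Fin k) (w : Vec (Fin k) n) where

  act-source : act (a , b) (a ∷ w) ≡ b ∷ act (a , b) w
  act-source with a ≟ a
  ... | yes _   = refl
  ... | no  a≢a = contradiction refl a≢a

  act-target : b ≢ a → act (a , b) (b ∷ w) ≡ a ∷ w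
  act-target b≢a with b ≟ a
  ... | yes b≡a = contradiction b≡a b≢a
  ... | no  _ with b ≟ b
  ...   | yes _   = refl
  ...   | no  b≢b = contradiction refl b≢b

  act-other : ∀ z → z ≢ a → z ≢ b → act (a , b) (z ∷ w) ≡ z ∷ w
  act-other z z≢a z≢b with z ≟ a
  ... | yes z≡a = contradiction z≡a z≢a
  ... | no  _ with z ≟ b
  ...   | yes z≡b = contradiction z≡b z≢b
  ...   | no  _   = refl

act-last : ∀ {k} m (a b : Fin k) → b ≢ a → (x : Vec (Fin k) (suc m)) →
           last (act (a , b) x) ≡ last x
           ⊎ (x ≡ replicate (suc m) a × act (a , b) x ≡ replicate (suc m) b)
           ⊎ (x ≡ replicate m a ∷ʳ b × act (a , b) x ≡ replicate m b ∷ʳ a)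
act-last zero a b b≢a (z ∷ []) with letter a b z
... | source        = inj₂ (inj₁ (refl , act-source a b []))
... | target _      = inj₂ (inj₂ (refl , act-target a b [] b≢a))
... | other z≢a z≢b = inj₁ (cong last (act-other a b [] z z≢a z≢b))
act-last (suc m) a b b≢a (z ∷ w) with letter a b z
... | target _      = inj₁ (cong last (act-target a b w b≢a))
... | other z≢a z≢b = inj₁ (cong last (act-other a b w z z≢a z≢b))
... | source with act-last m a b b≢a w
...   | inj₁ same              = inj₁ (trans (cong last (act-source a b w)) same)
...   | inj₂ (inj₁ (refl , q)) = inj₂ (inj₁ (refl , trans (act-source a b w) (cong (b ∷_) q)))
...   | inj₂ (inj₂ (refl , q)) = inj₂ (inj₂ (refl , trans (act-source a b w) (cong (b ∷_) q)))

last-replicate : ∀ {A : Set} m (z : A) → last (replicate (suc m) z) ≡ z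
last-replicate zero    z = refl
last-replicate (suc m) z = last-replicate m z

module _ {k : ℕ} {E : Edges k} where

  AdjΓ-sym : ∀ {n x y} → AdjΓ E n x y → AdjΓ E n y x
  AdjΓ-sym (f , f∈E , inj₁ fx≡y) = f , f∈E , inj₂ fx≡y
  AdjΓ-sym (f , f∈E , inj₂ fy≡x) = f , f∈E , inj₁ fy≡x

  AdjΓ? : ∀ n x y → Dec (AdjΓ E n x y)
  AdjΓ? n x y =
    map′ (λ any → let f , f∈E , p = find any in f , f∈E , p) (λ (f , f∈E , p) → lose f∈E p)
         (any? (λ f → Vec.≡-dec _≟_ (act f x) y ⊎-dec Vec.≡-dec _≟_ (act f y) x) E)

-- The Schreier graph of a tree

module Schreier {k : ℕ} {E : Edges k} (tree : IsTree E) {s t : Fin k} (st : (s , t) ∈ E) where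

  open Tree tree st

  Γ : ∀ n → Vec (Fin k) n → Vec (Fin k) n → Set
  Γ = AdjΓ E

  edge-distinct : ∀ {a b} → (a , b) ∈ E → b ≢ a
  edge-distinct ab b≡a = lookup (proj₁ (proj₁ tree)) ab (sym b≡a)

  lift-edge : ∀ {n} (w : Vec (Fin k) n) {a b} → G a b → Γ (suc n) (a ∷ w) (b ∷ w)
  lift-edge w {a} {b} (inj₁ ab) = (a , b) , ab , inj₂ (act-target a b w (edge-distinct ab))
  lift-edge w {a} {b} (inj₂ ba) = (b , a) , ba , inj₁ (act-target b a w (edge-distinct ba))

  lift-walk : ∀ {n} (w : Vec (Fin k) n) {a b l} → Walk G a b l → Walk (Γ (suc n)) (a ∷ w) (b ∷ w) l
  lift-walk w = Walk-map (_∷ w) (lift-edge w)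

  extend-edge : ∀ {n w w′} → Γ n w w′ → ∀ z → ∃ λ l → Walk (Γ (suc n)) (z ∷ w) (z ∷ w′) l
  extend-edge {w = w} {w′} ((a , b) , ab , inj₁ fw≡w′) z =
    _ , lift-walk w (proj₂ (connected z a))
        ++ʷ step ((a , b) , ab , inj₁ (trans (act-source a b w) (cong (b ∷_) fw≡w′)))
                 (lift-walk w′ (proj₂ (connected b z)))
  extend-edge (f , f∈E , inj₂ fw′≡w) z =
    let l , v = extend-edge (f , f∈E , inj₁ fw′≡w) z in l , reverse AdjΓ-sym v

  extend-walk : ∀ {n w w′ l} → Walk (Γ n) w w′ l → ∀ z → ∃ λ l′ → Walk (Γ (suc n)) (z ∷ w) (z ∷ w′) l′
  extend-walk here       z = _ , here
  extend-walk (step a v) z = _ , proj₂ (extend-edge a z) ++ʷ proj₂ (extend-walk v z)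

  Γ-connected : ∀ n → Connected (Γ n)
  Γ-connected zero    []      []        = 0 , here
  Γ-connected (suc n) (z ∷ w) (z′ ∷ w′) =
    _ , proj₂ (extend-walk (proj₂ (Γ-connected n w w′)) z) ++ʷ lift-walk w′ (proj₂ (connected z z′))

  Γ-walk? : ∀ n x y l → Dec (Walk (Γ n) x y l)
  Γ-walk? n = walk? (Vec.≡-dec _≟_) search-words (AdjΓ? n)

  e : Fin k × Fin k
  e = s , t

  Endpoint : Fin k → Set
  Endpoint z = z ≡ s ⊎ z ≡ t

  endpoint? : Decidable Endpoint
  endpoint? z = z ≟ s ⊎-dec z ≟ t

  OnCycle : ∀ {n} → Vec (Fin k) n → Set
  OnCycle = Vec.All Endpoint

  outsideOr : Fin k → Fin k → Fin k
  outsideOr c y with endpoint? y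
  ... | yes _ = c
  ... | no  _ = y

  lastOutside : ∀ {n} → Fin k → Vec (Fin k) n → Fin k
  lastOutside c []      = c
  lastOutside c (y ∷ w) = lastOutside (outsideOr c y) w

  -- π replaces every letter up to the last letter z outside {s, t} by side z.  It fixes
  -- the e-cycle {s,t}ⁿ and collapses every edge of Γ except the e-edges on that cycle.
  π : ∀ {n} → Vec (Fin k) n → Vec (Fin k) n
  π []      = []
  π (z ∷ w) = side (lastOutside z w) ∷ π w

  outsideOr-endpoint : ∀ c {y} → Endpoint y → outsideOr c y ≡ c
  outsideOr-endpoint c {y} y-end with endpoint? y
  ... | yes _     = refl
  ... | no  y-off = contradiction y-end y-off

  side-outsideOr : ∀ {c y d} → side c ≡ side d → side y ≡ side d → side (outsideOr c y) ≡ side d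
  side-outsideOr {c} {y} c∼d y∼d with endpoint? y
  ... | yes _ = c∼d
  ... | no  _ = y∼d

  lastOutside-endpoint : ∀ {n} c {y} (w : Vec (Fin k) n) → Endpoint y → lastOutside c (y ∷ w) ≡ lastOutside c w
  lastOutside-endpoint c w y-end = cong (λ c′ → lastOutside c′ w) (outsideOr-endpoint c y-end)

  lastOutside-onCycle : ∀ {n} c {w : Vec (Fin k) n} → OnCycle w → lastOutside c w ≡ c
  lastOutside-onCycle c Vec.[] = refl
  lastOutside-onCycle c {_ ∷ w} (y-end Vec.∷ w-on) =
    trans (lastOutside-endpoint c w y-end) (lastOutside-onCycle c w-on)

  lastOutside-offCycle : ∀ {n} c c′ (w : Vec (Fin k) n) → ¬ OnCycle w → lastOutside c w ≡ lastOutside c′ w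
  lastOutside-offCycle c c′ []      w-off = contradiction Vec.[] w-off
  lastOutside-offCycle c c′ (y ∷ w) w-off with endpoint? y
  ... | yes y-end = lastOutside-offCycle c c′ w (w-off ∘ (y-end Vec.∷_))
  ... | no  _     = refl

  side-lastOutside : ∀ {n c c′} (w : Vec (Fin k) n) → side c ≡ side c′ →
                     side (lastOutside c w) ≡ side (lastOutside c′ w)
  side-lastOutside []      c∼c′ = c∼c′
  side-lastOutside (y ∷ w) c∼c′ with endpoint? y
  ... | yes _ = side-lastOutside w c∼c′
  ... | no  _ = refl

  lastOutside-act-e : ∀ {n} c (w : Vec (Fin k) n) → lastOutside c (act e w) ≡ lastOutside c w
  lastOutside-act-e c [] = refl
  lastOutside-act-e c (y ∷ w) with letter s t y
  ... | source = begin
    lastOutside c (act e (s ∷ w))  ≡⟨ cong (lastOutside c) (act-source s t w) ⟩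
    lastOutside c (t ∷ act e w)    ≡⟨ lastOutside-endpoint c (act e w) (inj₂ refl) ⟩
    lastOutside c (act e w)        ≡⟨ lastOutside-act-e c w ⟩
    lastOutside c w                ≡⟨ lastOutside-endpoint c w (inj₁ refl) ⟨
    lastOutside c (s ∷ w)          ∎
  ... | target t≢s = begin
    lastOutside c (act e (t ∷ w))  ≡⟨ cong (lastOutside c) (act-target s t w t≢s) ⟩
    lastOutside c (s ∷ w)          ≡⟨ lastOutside-endpoint c w (inj₁ refl) ⟩
    lastOutside c w                ≡⟨ lastOutside-endpoint c w (inj₂ refl) ⟨
    lastOutside c (t ∷ w)          ∎
  ... | other y≢s y≢t = cong (lastOutside c) (act-other s t w y y≢s y≢t)

  side-lastOutside-act : ∀ {n a b c d} → side a ≡ side d → side b ≡ side d → side c ≡ side d →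
                         (w : Vec (Fin k) n) → side (lastOutside c (act (a , b) w)) ≡ side (lastOutside c w)
  side-lastOutside-act a∼d b∼d c∼d [] = refl
  side-lastOutside-act {a = a} {b} {c} a∼d b∼d c∼d (y ∷ w) with letter a b y
  ... | source = begin
    side (lastOutside c (act (a , b) (a ∷ w)))
      ≡⟨ cong (side ∘ lastOutside c) (act-source a b w) ⟩
    side (lastOutside (outsideOr c b) (act (a , b) w))
      ≡⟨ side-lastOutside-act a∼d b∼d (side-outsideOr c∼d b∼d) w ⟩
    side (lastOutside (outsideOr c b) w)
      ≡⟨ side-lastOutside w (trans (side-outsideOr c∼d b∼d) (sym (side-outsideOr c∼d a∼d))) ⟩
    side (lastOutside (outsideOr c a) w)
      ∎
  ... | target b≢a = begin
    side (lastOutside c (act (a , b) (b ∷ w)))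
      ≡⟨ cong (side ∘ lastOutside c) (act-target a b w b≢a) ⟩
    side (lastOutside (outsideOr c a) w)
      ≡⟨ side-lastOutside w (trans (side-outsideOr c∼d a∼d) (sym (side-outsideOr c∼d b∼d))) ⟩
    side (lastOutside (outsideOr c b) w)
      ∎
  ... | other y≢a y≢b = cong (side ∘ lastOutside c) (act-other a b w y y≢a y≢b)

  side-fixes-endpoints : ∀ {z} → Endpoint z → side z ≡ z
  side-fixes-endpoints (inj₁ refl) = side-s
  side-fixes-endpoints (inj₂ refl) = side-t

  π-onCycle : ∀ {n} {w : Vec (Fin k) n} → OnCycle w → π w ≡ w
  π-onCycle Vec.[] = refl
  π-onCycle {w = z ∷ w} (z-end Vec.∷ w-on) =
    cong₂ _∷_ (trans (cong side (lastOutside-onCycle z w-on)) (side-fixes-endpoints z-end)) (π-onCycle w-on)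

  π-lands-onCycle : ∀ {n} (w : Vec (Fin k) n) → OnCycle (π w)
  π-lands-onCycle []      = Vec.[]
  π-lands-onCycle (z ∷ w) = side-endpoint _ Vec.∷ π-lands-onCycle w

  π-act-sameSide : ∀ {n a b} → side a ≡ side b → (x : Vec (Fin k) n) → π (act (a , b) x) ≡ π x
  π-act-sameSide a∼b [] = refl
  π-act-sameSide {a = a} {b} a∼b (z ∷ w) with letter a b z
  ... | source = trans (cong π (act-source a b w))
    (cong₂ _∷_ (trans (side-lastOutside-act a∼b refl refl w) (side-lastOutside w (sym a∼b))) (π-act-sameSide a∼b w))
  ... | target b≢a    = trans (cong π (act-target a b w b≢a)) (cong (_∷ π w) (side-lastOutside w a∼b))
  ... | other z≢a z≢b = cong π (act-other a b w z z≢a z≢b)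

  π-act-e-offCycle : ∀ {n} (x : Vec (Fin k) n) → ¬ OnCycle x → π (act e x) ≡ π x
  π-act-e-offCycle []      x-off = contradiction Vec.[] x-off
  π-act-e-offCycle (z ∷ w) x-off with letter s t z
  ... | source = trans (cong π (act-source s t w))
    (cong₂ _∷_ (cong side (trans (lastOutside-act-e t w) (lastOutside-offCycle t s w w-off)))
               (π-act-e-offCycle w w-off))
    where
    w-off : ¬ OnCycle w
    w-off = x-off ∘ (inj₁ refl Vec.∷_)
  ... | target t≢s = trans (cong π (act-target s t w t≢s)) (cong (_∷ π w) (cong side (lastOutside-offCycle s t w w-off)))
    where
    w-off : ¬ OnCycle w
    w-off = x-off ∘ (inj₂ refl Vec.∷_)
  ... | other z≢s z≢t = cong π (act-other s t w z z≢s z≢t)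

  act-e-onCycle : ∀ {n} {x : Vec (Fin k) n} → OnCycle x → OnCycle (act e x)
  act-e-onCycle Vec.[] = Vec.[]
  act-e-onCycle {x = z ∷ w} (z-end Vec.∷ w-on) with letter s t z
  ... | source        = subst OnCycle (sym (act-source s t w)) (inj₂ refl Vec.∷ act-e-onCycle w-on)
  ... | target t≢s    = subst OnCycle (sym (act-target s t w t≢s)) (inj₁ refl Vec.∷ w-on)
  ... | other z≢s z≢t = ⊥-elim ([ z≢s , z≢t ]′ z-end)

  π-act : ∀ {n a b} → (a , b) ∈ E → (x : Vec (Fin k) n) →
          π (act (a , b) x) ≡ π x ⊎ π (act (a , b) x) ≡ act e (π x)
  π-act {a = a} {b} ab x with ≡-dec _≟_ _≟_ (a , b) e | Vec.all? endpoint? x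
  ... | yes refl | yes x-on  = inj₂ (trans (π-onCycle (act-e-onCycle x-on)) (cong (act e) (sym (π-onCycle x-on))))
  ... | yes refl | no  x-off = inj₁ (π-act-e-offCycle x x-off)
  ... | no  ab≢e | _         = inj₁ (π-act-sameSide (side-edge ab ab≢e) x)

  -- Only ever applied to the letters s and t.
  swap : Fin k → Fin k
  swap z with z ≟ s
  ... | yes _ = t
  ... | no  _ = s

  swap-s : swap s ≡ t
  swap-s with s ≟ s
  ... | yes _   = refl
  ... | no  s≢s = contradiction refl s≢s

  swap-t : swap t ≡ s
  swap-t with t ≟ s
  ... | yes t≡s = contradiction (sym t≡s) s≢t
  ... | no  _   = refl

  σ : ∀ {n} → Vec (Fin k) n → Vec (Fin k) n
  σ = map swap

  act-e-σ : ∀ {n} {c : Vec (Fin k) n} → OnCycle c → act e (σ (act e c)) ≡ σ c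
  act-e-σ Vec.[] = refl
  act-e-σ {c = s ∷ w} (inj₁ refl Vec.∷ w-on) = begin
    act e (σ (act e (s ∷ w)))     ≡⟨ cong (act e ∘ σ) (act-source s t w) ⟩
    act e (swap t ∷ σ (act e w))  ≡⟨ cong (λ z → act e (z ∷ σ (act e w))) swap-t ⟩
    act e (s ∷ σ (act e w))       ≡⟨ act-source s t _ ⟩
    t ∷ act e (σ (act e w))       ≡⟨ cong₂ _∷_ (sym swap-s) (act-e-σ w-on) ⟩
    swap s ∷ σ w                  ∎
  act-e-σ {c = t ∷ w} (inj₂ refl Vec.∷ w-on) = begin
    act e (σ (act e (t ∷ w)))     ≡⟨ cong (act e ∘ σ) (act-target s t w (s≢t ∘ sym)) ⟩
    act e (swap s ∷ σ w)          ≡⟨ cong (λ z → act e (z ∷ σ w)) swap-s ⟩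
    act e (t ∷ σ w)               ≡⟨ act-target s t _ (s≢t ∘ sym) ⟩
    s ∷ σ w                       ≡⟨ cong (_∷ σ w) swap-t ⟨
    swap t ∷ σ w                  ∎

  Φ : ∀ {n} → Vec (Fin k) n → Vec (Fin k) n
  Φ = σ ∘ π

  Φ-act : ∀ {n a b} → (a , b) ∈ E → (x : Vec (Fin k) n) →
          Φ x ≡ Φ (act (a , b) x) ⊎ Γ n (Φ x) (Φ (act (a , b) x))
  Φ-act ab x with π-act ab x
  ... | inj₁ π-same = inj₁ (cong σ (sym π-same))
  ... | inj₂ π-step = inj₂ (e , st , inj₂ (trans (cong (act e ∘ σ) π-step) (act-e-σ (π-lands-onCycle x))))

  Φ-edge : ∀ {n x y} → Γ n x y → Φ x ≡ Φ y ⊎ Γ n (Φ x) (Φ y)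
  Φ-edge (_ , ab , inj₁ refl) = Φ-act ab _
  Φ-edge (_ , ab , inj₂ refl) = Sum.map sym AdjΓ-sym (Φ-act ab _)

  Φ-walk : ∀ {n x y l} → Walk (Γ n) x y l → ∃ λ l′ → l′ ≤ l × Walk (Γ n) (Φ x) (Φ y) l′
  Φ-walk = Walk-map-≤ Φ Φ-edge

  replicate-onCycle : ∀ {n z} → Endpoint z → OnCycle (replicate n z)
  replicate-onCycle {zero}  z-end = Vec.[]
  replicate-onCycle {suc n} z-end = z-end Vec.∷ replicate-onCycle z-end

  ∷ʳ-onCycle : ∀ {n z} {w : Vec (Fin k) n} → OnCycle w → Endpoint z → OnCycle (w ∷ʳ z)
  ∷ʳ-onCycle Vec.[]             z-end = z-end Vec.∷ Vec.[]
  ∷ʳ-onCycle (y-end Vec.∷ w-on) z-end = y-end Vec.∷ ∷ʳ-onCycle w-on z-end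

  Φ-replicate : ∀ n {z} → Endpoint z → Φ (replicate n z) ≡ replicate n (swap z)
  Φ-replicate n {z} z-end = trans (cong σ (π-onCycle (replicate-onCycle z-end))) (map-replicate swap z n)

  Φ-replicate-∷ʳ : ∀ n {z y} → Endpoint z → Endpoint y → Φ (replicate n z ∷ʳ y) ≡ replicate n (swap z) ∷ʳ swap y
  Φ-replicate-∷ʳ n {z} {y} z-end y-end =
    trans (cong σ (π-onCycle (∷ʳ-onCycle (replicate-onCycle z-end) y-end)))
          (trans (map-∷ʳ swap y (replicate n z)) (cong (_∷ʳ swap y) (map-replicate swap z n)))

  module SpecialEdges (m : ℕ) where

    open Distances (Γ-walk? (suc m))

    sⁿ tⁿ sᵐt tᵐs : Vec (Fin k) (suc m)
    sⁿ  = replicate (suc m) s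
    tⁿ  = replicate (suc m) t
    sᵐt = replicate m s ∷ʳ t
    tᵐs = replicate m t ∷ʳ s

    Φ-sⁿ : Φ sⁿ ≡ tⁿ
    Φ-sⁿ = trans (Φ-replicate (suc m) (inj₁ refl)) (cong (replicate (suc m)) swap-s)

    Φ-tⁿ : Φ tⁿ ≡ sⁿ
    Φ-tⁿ = trans (Φ-replicate (suc m) (inj₂ refl)) (cong (replicate (suc m)) swap-t)

    Φ-sᵐt : Φ sᵐt ≡ tᵐs
    Φ-sᵐt = trans (Φ-replicate-∷ʳ m (inj₁ refl) (inj₂ refl)) (cong₂ (λ z y → replicate m z ∷ʳ y) swap-s swap-t)

    Φ-tᵐs : Φ tᵐs ≡ sᵐt
    Φ-tᵐs = trans (Φ-replicate-∷ʳ m (inj₂ refl) (inj₁ refl)) (cong₂ (λ z y → replicate m z ∷ʳ y) swap-t swap-s)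

    EndsNearS : Vec (Fin k) (suc m) → Set
    EndsNearS x = NearS (last x)

    endsNearS? : Decidable EndsNearS
    endsNearS? = nearS? ∘ last

    exit-forward : ∀ {a b} → (a , b) ∈ E → ∀ x → EndsNearS x → ¬ EndsNearS (act (a , b) x) →
                   x ≡ sⁿ × act (a , b) x ≡ tⁿ
    exit-forward {a} {b} ab x near far with act-last m a b (edge-distinct ab) x
    ... | inj₁ same = contradiction (subst NearS (sym same) near) far
    ... | inj₂ (inj₂ (refl , fx≡bᵐa)) = ⊥-elim (¬crossing-backwards ab
          (far ∘ subst NearS (sym (trans (cong last fx≡bᵐa) (last-∷ʳ a (replicate m b)))))
          (subst NearS (last-∷ʳ b (replicate m a)) near))
    ... | inj₂ (inj₁ (refl , fx≡bⁿ))
          with crossing-edge ab (subst NearS (last-replicate m a) near)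
                                (far ∘ subst NearS (sym (trans (cong last fx≡bⁿ) (last-replicate m b))))
    ...   | refl , refl = refl , fx≡bⁿ

    exit-backward : ∀ {a b} → (a , b) ∈ E → ∀ x → ¬ EndsNearS x → EndsNearS (act (a , b) x) →
                    x ≡ sᵐt × act (a , b) x ≡ tᵐs
    exit-backward {a} {b} ab x far near with act-last m a b (edge-distinct ab) x
    ... | inj₁ same = contradiction (subst NearS same near) far
    ... | inj₂ (inj₁ (refl , fx≡bⁿ)) = ⊥-elim (¬crossing-backwards ab
          (far ∘ subst NearS (sym (last-replicate m a)))
          (subst NearS (trans (cong last fx≡bⁿ) (last-replicate m b)) near))
    ... | inj₂ (inj₂ (refl , fx≡bᵐa))
          with crossing-edge ab (subst NearS (trans (cong last fx≡bᵐa) (last-∷ʳ a (replicate m b))) near)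
                                (far ∘ subst NearS (sym (last-∷ʳ b (replicate m a))))
    ...   | refl , refl = refl , fx≡bᵐa

    Γ-crossing : ∀ {x y} → EndsNearS x → ¬ EndsNearS y → Γ (suc m) x y →
                 (x ≡ sⁿ × y ≡ tⁿ) ⊎ (x ≡ tᵐs × y ≡ sᵐt)
    Γ-crossing near far (_ , ab , inj₁ refl) = inj₁ (exit-forward ab _ near far)
    Γ-crossing near far (_ , ab , inj₂ refl) = inj₂ (Product.swap (exit-backward ab _ far near))

    Γ-crossing-back : ∀ {x y} → ¬ EndsNearS x → ¬ ¬ EndsNearS y → Γ (suc m) x y →
                      (x ≡ tⁿ × y ≡ sⁿ) ⊎ (x ≡ sᵐt × y ≡ tᵐs)
    Γ-crossing-back far not-far x~y = Sum.map Product.swap Product.swap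
      (Γ-crossing (decidable-stable (endsNearS? _) not-far) far (AdjΓ-sym x~y))

    exit-via-Φ : ∀ {P : Vec (Fin k) (suc m) → Set} {a b a′ b′} →
                 (∀ {x y} → P x → ¬ P y → Γ (suc m) x y → (x ≡ a × y ≡ b) ⊎ (x ≡ a′ × y ≡ b′)) →
                 Φ b′ ≡ a′ → Φ b ≡ a →
                 ∀ {x y} → P x → ¬ P y → Γ (suc m) x y → ∀ {l} → Walk (Γ (suc m)) y b l →
                 ∃ λ l′ → l′ ≤ l × Walk (Γ (suc m)) x a l′
    exit-via-Φ crossing Φb′ Φb x∈P y∉P x~y w with crossing x∈P y∉P x~y
    ... | inj₁ (refl , refl) = 0 , z≤n , here
    ... | inj₂ (refl , refl) =
      let l′ , l′≤l , v = Φ-walk w in l′ , l′≤l , subst₂ (λ u u′ → Walk (Γ (suc m)) u u′ l′) Φb′ Φb v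

    LastLetterSplit : Vec (Fin k) (suc m) → Vec (Fin k) (suc m) → Set
    LastLetterSplit u v =
      ∀ x → (Closer (Γ (suc m)) u v x ⇔ EndsNearS x) × (Closer (Γ (suc m)) v u x ⇔ (¬ EndsNearS x))

    sⁿ-tⁿ-split : LastLetterSplit sⁿ tⁿ
    sⁿ-tⁿ-split = Closer-by-cut (Γ-connected (suc m)) endsNearS?
      (Shortcut-inside endsNearS? tⁿ-far (exit-via-Φ Γ-crossing Φ-sᵐt Φ-tⁿ))
      (Shortcut-inside (¬? ∘ endsNearS?) (λ sⁿ-far → sⁿ-far sⁿ-near) (exit-via-Φ Γ-crossing-back Φ-tᵐs Φ-sⁿ))
      where
      sⁿ-near : EndsNearS sⁿ
      sⁿ-near = subst NearS (sym (last-replicate m s)) s-nearS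
      tⁿ-far : ¬ EndsNearS tⁿ
      tⁿ-far = t-not-nearS ∘ subst NearS (last-replicate m t)

    tᵐs-sᵐt-split : LastLetterSplit tᵐs sᵐt
    tᵐs-sᵐt-split = Closer-by-cut (Γ-connected (suc m)) endsNearS?
      (Shortcut-inside endsNearS? sᵐt-far (exit-via-Φ (λ near far → Sum.swap ∘ Γ-crossing near far) Φ-tⁿ Φ-sᵐt))
      (Shortcut-inside (¬? ∘ endsNearS?) (λ tᵐs-far → tᵐs-far tᵐs-near)
        (exit-via-Φ (λ far not-far → Sum.swap ∘ Γ-crossing-back far not-far) Φ-sⁿ Φ-tᵐs))
      where
      tᵐs-near : EndsNearS tᵐs
      tᵐs-near = subst NearS (sym (last-∷ʳ s (replicate m t))) s-nearS
      sᵐt-far : ¬ EndsNearS sᵐt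
      sᵐt-far = t-not-nearS ∘ subst NearS (last-∷ʳ t (replicate m s))

    special-edge-split : ∀ {u v} → SpecialEdge m s t u v → LastLetterSplit u v ⊎ LastLetterSplit v u
    special-edge-split (inj₁ (refl , refl))                = inj₁ sⁿ-tⁿ-split
    special-edge-split (inj₂ (inj₁ (refl , refl)))         = inj₂ sⁿ-tⁿ-split
    special-edge-split (inj₂ (inj₂ (inj₁ (refl , refl)))) = inj₂ tᵐs-sᵐt-split
    special-edge-split (inj₂ (inj₂ (inj₂ (refl , refl)))) = inj₁ tᵐs-sᵐt-split

    count-near : ∀ {u v N Nst} → LastLetterSplit u v → nCloser (Γ (suc m)) u v N → nCloser G s t Nst →
                 N ≡ k ^ m * Nst
    count-near split cuv cst =
      HasCount-unique (Γ (suc m)) (HasCount-resp (Γ (suc m)) (proj₁ ∘ split) cuv) (HasCount-last G (Γ (suc m)) cst)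

    count-far : ∀ {u v N Nts} → LastLetterSplit u v → nCloser (Γ (suc m)) v u N → nCloser G t s Nts →
                N ≡ k ^ m * Nts
    count-far split cvu cts =
      HasCount-unique (Γ (suc m)) (HasCount-resp (Γ (suc m)) (proj₂ ∘ split) cvu)
                      (HasCount-last G (Γ (suc m)) (HasCount-resp G nearT⇔¬nearS cts))

    special-product : ∀ {u v Nuv Nvu Nst Nts} → SpecialEdge m s t u v →
                      nCloser (Γ (suc m)) u v Nuv → nCloser (Γ (suc m)) v u Nvu →
                      nCloser G s t Nst → nCloser G t s Nts → Nuv * Nvu ≡ (k ^ m * Nst) * (k ^ m * Nts)
    special-product {Nuv = Nuv} {Nvu} special cuv cvu cst cts with special-edge-split special
    ... | inj₁ split = cong₂ _*_ (count-near split cuv cst) (count-far split cvu cts)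
    ... | inj₂ split = trans (*-comm Nuv Nvu) (cong₂ _*_ (count-near split cvu cst) (count-far split cuv cts))

product-forms : ∀ {k} m A B → A + B ≡ k → ∀ {P} → P ≡ (k ^ m * A) * (k ^ m * B) →
                (P ≡ A * B * k ^ (2 * m))
                × (P ≡ A * k ^ m * (k ^ suc m ∸ A * k ^ m))
                × (P ≡ B * k ^ m * (k ^ suc m ∸ B * k ^ m))
product-forms m A B refl refl =
  trans (solve 3 (λ a b c → (c :* a) :* (c :* b) := a :* b :* (c :* c)) refl A B K) (cong (A * B *_) (sym square)) ,
  trans (solve 3 (λ a b c → (c :* a) :* (c :* b) := a :* c :* (b :* c)) refl A B K) (cong (A * K *_) (sym rest-A)) ,
  trans (solve 3 (λ a b c → (c :* a) :* (c :* b) := b :* c :* (a :* c)) refl A B K) (cong (B * K *_) (sym rest-B))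
  where
  open +-*-Solver
  K : ℕ
  K = (A + B) ^ m
  square : (A + B) ^ (2 * m) ≡ K * K
  square = trans (^-distribˡ-+-* (A + B) m (m + 0)) (cong (λ j → K * (A + B) ^ j) (+-identityʳ m))
  rest-A : (A + B) ^ suc m ∸ A * K ≡ B * K
  rest-A = trans (cong (_∸ A * K) (*-distribʳ-+ K A B)) (m+n∸m≡n (A * K) (B * K))
  rest-B : (A + B) ^ suc m ∸ B * K ≡ A * K
  rest-B = trans (cong (_∸ B * K) (trans (*-distribʳ-+ K A B) (+-comm (A * K) (B * K)))) (m+n∸m≡n (B * K) (A * K))

mainTheorem9 : ∀ (k : ℕ) (E : Edges k) → IsTree E →
    ∀ (m : ℕ) (s t : Fin k) → (s , t) ∈ E →
    ∀ (u v : Vec (Fin k) (suc m)) → SpecialEdge m s t u v →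
    ∀ (Nuv Nvu Nst Nts : ℕ) →
    nCloser (AdjΓ E (suc m)) u v Nuv → nCloser (AdjΓ E (suc m)) v u Nvu →
    nCloser (AdjG E) s t Nst → nCloser (AdjG E) t s Nts →
    (Nuv * Nvu ≡ Nst * Nts * k ^ (2 * m))
    × (Nuv * Nvu ≡ Nst * k ^ m * (k ^ suc m ∸ Nst * k ^ m))
    × (Nuv * Nvu ≡ Nts * k ^ m * (k ^ suc m ∸ Nts * k ^ m))
mainTheorem9 k E tree m s t st u v special Nuv Nvu Nst Nts cuv cvu cst cts =
  product-forms m Nst Nts (sides-partition cst cts) (special-product special cuv cvu cst cts)
  where
  open Tree tree st using (sides-partition)
  open Schreier tree st using (module SpecialEdges)
  open SpecialEdges m using (special-product)
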